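{- Let $K_n$ be the complete graph with vertices $v_1,\dots,v_n$, and let $f:V(K_n)\to 2^{\mathbb{N}_0}$ be an integer additive set-indexer with $f(v_i)=A_i$, where each $A_i$ is a non-empty finite set. For each $i$ let $D_i=\{a-a' : a,a'\in A_i,\ a>a'\}$ be the difference set of $A_i$. Then $f$ is a strong integer additive set-indexer of $K_n$ if and only if the sets $D_1,D_2,\dots,D_n$ are pairwise disjoint.
   Context: All graphs are simple and finite. $\mathbb{N}_0$ is the set of non-negative integers and $2^{\mathbb{N}_0}$ its power set; all set-labels are non-empty finite sets. For sets $A,B$, $A+B=\{a+b: a\in A, b\in B\}$. An integer additive set-indexer (IASI) of a graph $G$ is an injective function $f:V(G)\to 2^{\mathbb{N}_0}$ such that the induced function $f^+:E(G)\to 2^{\mathbb{N}_0}$, $f^+(uv)=f(u)+f(v)$, is also injective. An IASI $f$ is strong if $|f^+(uv)|=|f(u)|\,|f(v)|$ for every edge $uv$. -}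

module Defs where

open import Data.Nat using (ℕ; _+_; _∸_; _<_; _*_)
open import Data.Nat.Properties using (_≟_)
open import Data.Fin using (Fin)
open import Data.List using (List; []; length; deduplicate; cartesianProductWith)
open import Data.List.Membership.Propositional using (_∈_)
open import Data.Sum using (_⊎_)
open import Data.Product using (_×_; ∃-syntax)
open import Relation.Binary.PropositionalEquality using (_≡_; _≢_)
open import Relation.Nullary using (¬_)
open import Function.Bundles using (_⇔_)

-- A finite subset of ℕ₀ is represented by a list of its elements
-- (repetitions and order are irrelevant; sets are compared by membership).
FinSet : Set
FinSet = List ℕ

NonEmpty : FinSet → Set
NonEmpty A = A ≢ []

_≐_ : FinSet → FinSet → Set
A ≐ B = ∀ x → (x ∈ A) ⇔ (x ∈ B)

card : FinSet → ℕ
card A = length (deduplicate _≟_ A)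

_⊕_ : FinSet → FinSet → FinSet
A ⊕ B = cartesianProductWith _+_ A B

-- Complete graph K_n: vertices Fin n, every pair of distinct vertices is an edge.
-- Edges are unordered pairs; edge {i,j} = edge {k,l} iff (i,j) = (k,l) or (i,j) = (l,k).
SameEdge : ∀ {n} → Fin n → Fin n → Fin n → Fin n → Set
SameEdge i j k l = (i ≡ k × j ≡ l) ⊎ (i ≡ l × j ≡ k)

IsIASI : ∀ n → (Fin n → FinSet) → Set
IsIASI n A =
  (∀ i → NonEmpty (A i)) ×
  (∀ i j → i ≢ j → ¬ (A i ≐ A j)) ×
  (∀ i j k l → i ≢ j → k ≢ l → ¬ SameEdge i j k l →
     ¬ ((A i ⊕ A j) ≐ (A k ⊕ A l)))

IsStrongIASI : ∀ n → (Fin n → FinSet) → Set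
IsStrongIASI n A =
  IsIASI n A × (∀ i j → i ≢ j → card (A i ⊕ A j) ≡ card (A i) * card (A j))

_∈D_ : ℕ → FinSet → Set
d ∈D A = ∃[ a ] ∃[ a' ] (a ∈ A × a' ∈ A × a' < a × d ≡ a ∸ a')

PairwiseDisjointDiff : ∀ n → (Fin n → FinSet) → Set
PairwiseDisjointDiff n A = ∀ i j → i ≢ j → ∀ d → ¬ (d ∈D A i × d ∈D A j)

-- For duplicate-free lists A′, B′ of the elements of A, B, the list A′ ⊕ B′ is the image of
-- the card A · card B pairs of A′ × B′ under addition, so card (A ⊕ B) = card A · card B
-- exactly when addition is injective on A × B. A coincidence a + b = a′ + b′ with a′ < a is
-- the same thing as a − a′ = b′ − b being a common difference of A and B.
module Submission where

open import Defs
open import Data.Nat using (ℕ; suc; _+_; _∸_; _*_; _≤_; _<_; z≤n; s≤s)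
open import Data.Nat.Properties
open import Data.Fin using (Fin)
open import Data.List
  using (List; []; _∷_; _++_; length; map; deduplicate; cartesianProductWith; cartesianProduct)
open import Data.List.Properties using (length-++; length-++-sucʳ; length-map; map-++; map-∘; length-deduplicate)
open import Data.List.Membership.Propositional using (_∈_)
open import Data.List.Membership.Propositional.Properties
open import Data.List.Relation.Binary.Subset.Propositional using (_⊆_)
open import Data.List.Relation.Unary.Any using (here; there)
import Data.List.Relation.Unary.All as All
open import Data.List.Relation.Unary.All.Properties using (map⁺)
open import Data.List.Relation.Unary.AllPairs using ([]; _∷_)
open import Data.List.Relation.Unary.Unique.Propositional using (Unique)
open import Data.List.Relation.Unary.Unique.Propositional.Properties using (cartesianProduct⁺)
open import Data.List.Relation.Unary.Unique.DecPropositional.Properties using (deduplicate-!)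
open import Data.Product using (_×_; _,_; proj₁; uncurry)
open import Data.Sum using (inj₁; inj₂)
open import Data.Empty using (⊥-elim)
open import Function using (_∘_)
open import Function.Bundles using (_⇔_; mk⇔; Equivalence)
import Function.Properties.Equivalence as ⇔
open import Relation.Nullary using (¬_; yes; no)
open import Relation.Binary.Definitions using (tri<; tri≈; tri>)
open import Relation.Binary.PropositionalEquality
  using (_≡_; _≢_; refl; sym; trans; cong; cong₂; subst; module ≡-Reasoning)

dedup : FinSet → FinSet
dedup = deduplicate _≟_

∈-++-∷⁻ : ∀ {A : Set} {x y : A} us vs → x ∈ us ++ y ∷ vs → x ≢ y → x ∈ us ++ vs
∈-++-∷⁻ us vs x∈ x≢y with ∈-++⁻ us x∈
... | inj₁ x∈us         = ∈-++⁺ˡ x∈us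
... | inj₂ (here refl)  = ⊥-elim (x≢y refl)
... | inj₂ (there x∈vs) = ∈-++⁺ʳ us x∈vs

Unique⇒length≤ : ∀ {A : Set} {xs ys : List A} → Unique xs → xs ⊆ ys → length xs ≤ length ys
Unique⇒length≤ {xs = []}     _            _    = z≤n
Unique⇒length≤ {xs = x ∷ xs} (x∉xs ∷ xs!) x∷xs⊆ys with ∈-∃++ (x∷xs⊆ys (here refl))
... | us , vs , refl = subst (suc (length xs) ≤_) (sym (length-++-sucʳ us x vs))
  (s≤s (Unique⇒length≤ xs! λ z∈xs →
    ∈-++-∷⁻ us vs (x∷xs⊆ys (there z∈xs)) (All.lookup x∉xs z∈xs ∘ sym)))

card-mono : ∀ {xs ys} → xs ⊆ ys → card xs ≤ card ys
card-mono {xs} xs⊆ys = Unique⇒length≤ (deduplicate-! _≟_ xs)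
  (∈-deduplicate⁺ _≟_ ∘ xs⊆ys ∘ ∈-deduplicate⁻ _≟_ xs)

card-cong : ∀ {xs ys} → xs ⊆ ys → ys ⊆ xs → card xs ≡ card ys
card-cong xs⊆ys ys⊆xs = ≤-antisym (card-mono xs⊆ys) (card-mono ys⊆xs)

card-unique : ∀ {xs} → Unique xs → card xs ≡ length xs
card-unique {xs} xs! = ≤-antisym (length-deduplicate _≟_ xs) (Unique⇒length≤ xs! (∈-deduplicate⁺ _≟_))

card-duplicate : ∀ {x} us vs → x ∈ us ++ vs → card (us ++ x ∷ vs) < length (us ++ x ∷ vs)
card-duplicate {x} us vs x∈ = begin-strict
  card (us ++ x ∷ vs)   ≤⟨ card-mono drop-x ⟩
  card (us ++ vs)       ≤⟨ length-deduplicate _≟_ (us ++ vs) ⟩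
  length (us ++ vs)     <⟨ n<1+n _ ⟩
  suc (length (us ++ vs)) ≡⟨ length-++-sucʳ us x vs ⟨
  length (us ++ x ∷ vs) ∎
  where
  open ≤-Reasoning
  drop-x : us ++ x ∷ vs ⊆ us ++ vs
  drop-x {z} z∈ with ∈-++⁻ us z∈
  ... | inj₁ z∈us         = ∈-++⁺ˡ z∈us
  ... | inj₂ (here refl)  = x∈
  ... | inj₂ (there z∈vs) = ∈-++⁺ʳ us z∈vs

card-map-collision : ∀ {A : Set} (g : A → ℕ) {xs p q} → p ∈ xs → q ∈ xs → p ≢ q → g p ≡ g q →
                     card (map g xs) < length xs
card-map-collision g {p = p} {q} p∈ q∈ p≢q gp≡gq with ∈-∃++ q∈
... | us , vs , refl = begin-strict
  card (map g (us ++ q ∷ vs))         ≡⟨ cong card (map-++ g us (q ∷ vs)) ⟩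
  card (map g us ++ g q ∷ map g vs)   <⟨ card-duplicate (map g us) (map g vs) gq∈ ⟩
  length (map g us ++ g q ∷ map g vs) ≡⟨ cong length (map-++ g us (q ∷ vs)) ⟨
  length (map g (us ++ q ∷ vs))       ≡⟨ length-map g (us ++ q ∷ vs) ⟩
  length (us ++ q ∷ vs)               ∎
  where
  open ≤-Reasoning
  gq∈ : g q ∈ map g us ++ map g vs
  gq∈ = subst (_∈ map g us ++ map g vs) gp≡gq
    (subst (g p ∈_) (map-++ g us vs) (∈-map⁺ g (∈-++-∷⁻ us vs p∈ p≢q)))

Unique-map⁺ : ∀ {A B : Set} (f : A → B) {xs} → (∀ {x y} → x ∈ xs → y ∈ xs → f x ≡ f y → x ≡ y) →
              Unique xs → Unique (map f xs)
Unique-map⁺ f {[]}     _   []           = []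
Unique-map⁺ f {x ∷ xs} inj (x∉xs ∷ xs!) =
  map⁺ (All.tabulate λ y∈ fx≡fy → All.lookup x∉xs y∈ (inj (here refl) (there y∈) fx≡fy))
  ∷ Unique-map⁺ f (λ x∈ y∈ → inj (there x∈) (there y∈)) xs!

card-map-injective : ∀ {A : Set} (g : A → ℕ) {xs} → (∀ {x y} → x ∈ xs → y ∈ xs → g x ≡ g y → x ≡ y) →
                     Unique xs → card (map g xs) ≡ length xs
card-map-injective g {xs} inj xs! = trans (card-unique (Unique-map⁺ g inj xs!)) (length-map g xs)

cartesianProductWith-map : ∀ {A B C : Set} (f : A → B → C) xs ys →
                           cartesianProductWith f xs ys ≡ map (uncurry f) (cartesianProduct xs ys)
cartesianProductWith-map f []       ys = refl
cartesianProductWith-map f (x ∷ xs) ys = begin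
  map (f x) ys ++ cartesianProductWith f xs ys
    ≡⟨ cong₂ _++_ (map-∘ ys) (cartesianProductWith-map f xs ys) ⟩
  map (uncurry f) (map (x ,_) ys) ++ map (uncurry f) (cartesianProduct xs ys)
    ≡⟨ map-++ (uncurry f) (map (x ,_) ys) (cartesianProduct xs ys) ⟨
  map (uncurry f) (cartesianProduct (x ∷ xs) ys) ∎
  where open ≡-Reasoning

length-cartesianProductWith : ∀ {A B C : Set} (f : A → B → C) xs ys →
                              length (cartesianProductWith f xs ys) ≡ length xs * length ys
length-cartesianProductWith f []       ys = refl
length-cartesianProductWith f (x ∷ xs) ys = begin
  length (map (f x) ys ++ cartesianProductWith f xs ys)
    ≡⟨ length-++ (map (f x) ys) ⟩
  length (map (f x) ys) + length (cartesianProductWith f xs ys)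
    ≡⟨ cong₂ _+_ (length-map (f x) ys) (length-cartesianProductWith f xs ys) ⟩
  length ys + length xs * length ys ∎
  where open ≡-Reasoning

⊕-mono : ∀ {A A′ B B′} → A ⊆ A′ → B ⊆ B′ → A ⊕ B ⊆ A′ ⊕ B′
⊕-mono {A} {_} {B} A⊆A′ B⊆B′ c∈ with ∈-cartesianProductWith⁻ _+_ A B c∈
... | _ , _ , a∈ , b∈ , refl = ∈-cartesianProductWith⁺ _+_ (A⊆A′ a∈) (B⊆B′ b∈)

UniqueSums : FinSet → FinSet → Set
UniqueSums A B = ∀ {a a′ b b′} → a ∈ A → a′ ∈ A → b ∈ B → b′ ∈ B → a + b ≡ a′ + b′ → a ≡ a′ × b ≡ b′

module _ (A B : FinSet) where

  pairs : List (ℕ × ℕ)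
  pairs = cartesianProduct (dedup A) (dedup B)

  card-⊕≡card-sums : card (A ⊕ B) ≡ card (map (uncurry _+_) pairs)
  card-⊕≡card-sums = trans
    (card-cong (⊕-mono {A} {_} {B} (∈-deduplicate⁺ _≟_) (∈-deduplicate⁺ _≟_))
               (⊕-mono (∈-deduplicate⁻ _≟_ A) (∈-deduplicate⁻ _≟_ B)))
    (cong card (cartesianProductWith-map _+_ (dedup A) (dedup B)))

  length-pairs : length pairs ≡ card A * card B
  length-pairs = length-cartesianProductWith _,_ (dedup A) (dedup B)

  card-⊕≡*⇔UniqueSums : card (A ⊕ B) ≡ card A * card B ⇔ UniqueSums A B
  card-⊕≡*⇔UniqueSums = mk⇔ card≡⇒unique unique⇒card≡
    where
    pair∈ : ∀ {a b} → a ∈ A → b ∈ B → (a , b) ∈ pairs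
    pair∈ a∈ b∈ = ∈-cartesianProduct⁺ (∈-deduplicate⁺ _≟_ a∈) (∈-deduplicate⁺ _≟_ b∈)

    card≡⇒unique : card (A ⊕ B) ≡ card A * card B → UniqueSums A B
    card≡⇒unique card≡ {a} {a′} {b} {b′} a∈ a′∈ b∈ b′∈ sum≡ with a ≟ a′
    ... | yes refl = refl , +-cancelˡ-≡ a b b′ sum≡
    ... | no a≢a′  = ⊥-elim (<-irrefl card≡ (begin-strict
      card (A ⊕ B)                     ≡⟨ card-⊕≡card-sums ⟩
      card (map (uncurry _+_) pairs)   <⟨ card-map-collision (uncurry _+_)
                                            (pair∈ a∈ b∈) (pair∈ a′∈ b′∈) (a≢a′ ∘ cong proj₁) sum≡ ⟩
      length pairs                     ≡⟨ length-pairs ⟩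
      card A * card B                  ∎))
      where open ≤-Reasoning

    unique⇒card≡ : UniqueSums A B → card (A ⊕ B) ≡ card A * card B
    unique⇒card≡ unique = begin
      card (A ⊕ B)                     ≡⟨ card-⊕≡card-sums ⟩
      card (map (uncurry _+_) pairs)   ≡⟨ card-map-injective (uncurry _+_) sum-injective
                                            (cartesianProduct⁺ (deduplicate-! _≟_ A) (deduplicate-! _≟_ B)) ⟩
      length pairs                     ≡⟨ length-pairs ⟩
      card A * card B                  ∎
      where
      open ≡-Reasoning
      sum-injective : ∀ {p q} → p ∈ pairs → q ∈ pairs → uncurry _+_ p ≡ uncurry _+_ q → p ≡ q
      sum-injective p∈ q∈ sum≡
        with a∈ , b∈ ← ∈-cartesianProduct⁻ (dedup A) (dedup B) p∈
           | a′∈ , b′∈ ← ∈-cartesianProduct⁻ (dedup A) (dedup B) q∈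
        with refl , refl ← unique (∈-deduplicate⁻ _≟_ A a∈) (∈-deduplicate⁻ _≟_ A a′∈)
                                  (∈-deduplicate⁻ _≟_ B b∈) (∈-deduplicate⁻ _≟_ B b′∈) sum≡
        = refl

DisjointDifferences : FinSet → FinSet → Set
DisjointDifferences A B = ∀ d → ¬ (d ∈D A × d ∈D B)

+≡+⇒∸≡∸ : ∀ {a a′ b b′} → a + b ≡ a′ + b′ → a ∸ a′ ≡ b′ ∸ b
+≡+⇒∸≡∸ {a} {a′} {b} {b′} sum≡ = begin
  a ∸ a′                ≡⟨ [m+n]∸[m+o]≡n∸o b a a′ ⟨
  (b + a) ∸ (b + a′)    ≡⟨ cong₂ _∸_ (trans (+-comm b a) sum≡) (+-comm b a′) ⟩
  (a′ + b′) ∸ (a′ + b)  ≡⟨ [m+n]∸[m+o]≡n∸o a′ b′ b ⟩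
  b′ ∸ b                ∎
  where open ≡-Reasoning

∸≡∸⇒+≡+ : ∀ {a a′ b b′} → a′ ≤ a → b′ ≤ b → a ∸ a′ ≡ b ∸ b′ → a + b′ ≡ a′ + b
∸≡∸⇒+≡+ {a} {a′} {b} {b′} a′≤a b′≤b diff≡ = begin
  a + b′                ≡⟨ cong (_+ b′) (m+[n∸m]≡n a′≤a) ⟨
  a′ + (a ∸ a′) + b′    ≡⟨ +-assoc a′ (a ∸ a′) b′ ⟩
  a′ + ((a ∸ a′) + b′)  ≡⟨ cong (λ d → a′ + (d + b′)) diff≡ ⟩
  a′ + ((b ∸ b′) + b′)  ≡⟨ cong (a′ +_) (m∸n+n≡m b′≤b) ⟩
  a′ + b                ∎
  where open ≡-Reasoning

common-difference : ∀ {A B a a′ b b′} → a′ < a → a ∈ A → a′ ∈ A → b ∈ B → b′ ∈ B →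
                    a + b ≡ a′ + b′ → (a ∸ a′) ∈D A × (a ∸ a′) ∈D B
common-difference {a = a} {a′} {b} {b′} a′<a a∈ a′∈ b∈ b′∈ sum≡ =
  (a , a′ , a∈ , a′∈ , a′<a , refl) , (b′ , b , b′∈ , b∈ , b<b′ , +≡+⇒∸≡∸ {a} {a′} {b} {b′} sum≡)
  where
  b<b′ : b < b′
  b<b′ = +-cancelˡ-< a′ b b′ (subst (a′ + b <_) sum≡ (+-monoˡ-< b a′<a))

UniqueSums⇔DisjointDifferences : ∀ {A B} → UniqueSums A B ⇔ DisjointDifferences A B
UniqueSums⇔DisjointDifferences {A} {B} = mk⇔ unique⇒disjoint disjoint⇒unique
  where
  unique⇒disjoint : UniqueSums A B → DisjointDifferences A B
  unique⇒disjoint unique _ ((a , a′ , a∈ , a′∈ , a′<a , refl) , (b , b′ , b∈ , b′∈ , b′<b , diff≡)) =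
    <-irrefl (sym (proj₁ (unique a∈ a′∈ b′∈ b∈ (∸≡∸⇒+≡+ (<⇒≤ a′<a) (<⇒≤ b′<b) diff≡)))) a′<a

  disjoint⇒unique : DisjointDifferences A B → UniqueSums A B
  disjoint⇒unique disjoint {a} {a′} {b} {b′} a∈ a′∈ b∈ b′∈ sum≡ with <-cmp a a′
  ... | tri< a<a′ _ _ = ⊥-elim (disjoint _ (common-difference a<a′ a′∈ a∈ b′∈ b∈ (sym sum≡)))
  ... | tri≈ _ refl _ = refl , +-cancelˡ-≡ a b b′ sum≡
  ... | tri> _ _ a′<a = ⊥-elim (disjoint _ (common-difference a′<a a∈ a′∈ b∈ b′∈ sum≡))

card-⊕≡*⇔DisjointDifferences : ∀ A B → card (A ⊕ B) ≡ card A * card B ⇔ DisjointDifferences A B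
card-⊕≡*⇔DisjointDifferences A B = ⇔.trans (card-⊕≡*⇔UniqueSums A B) UniqueSums⇔DisjointDifferences

theorem1 : (n : ℕ) (A : Fin n → FinSet) → IsIASI n A →
    (IsStrongIASI n A ⇔ PairwiseDisjointDiff n A)
theorem1 n A iasi = mk⇔
  (λ (_ , strong) i j i≢j → to (card-⊕≡*⇔DisjointDifferences (A i) (A j)) (strong i j i≢j))
  (λ disjoint → iasi , λ i j i≢j → from (card-⊕≡*⇔DisjointDifferences (A i) (A j)) (disjoint i j i≢j))
  where open Equivalence
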